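{- Let $P=([n],\prec)$ be any finite interval order. Let $M_P$ be the $\{0,\pm1\}$-matrix whose $2n$ columns correspond, in this order, to the variables $\ell_1,\dots,\ell_n,\rho_1,\dots,\rho_n$, and whose rows are the coefficient vectors of the left-hand sides of the following inequalities: - $\ell_x+\rho_x-\ell_y\le -1$ for each slack zero cover pair $(x,y)$; - $\ell_x-\ell_y-\rho_y\le 0$ for each slack zero sharp pair $(x,y)$; - $-\rho_x\le 0$ for each $x$ such that $(x,x)$ is a slack zero pair; - $-\ell_x\le 0$ for every $x\in[n]$. Then $M_P$ is totally unimodular.
   Context: A finite partial order $P=([n],\prec)$ is an interval order if there are compact real intervals $I_x=[\ell_x,r_x]$, $x\in[n]$, such that $x\prec y$ if and only if $r_x<\ell_y$. Write $x\parallel y$ if $x\neq y$ and $x,y$ are incomparable. The canonical representation $\mathcal C=[\ell_x,r_x]_{x\in[n]}$ of $P$ is the (unique) interval representation of $P$ using the minimum possible number $m$ of distinct endpoints, with these endpoints placed at the integers $0,1,\dots,m-1$. For $x,y\in[n]$ with $y\not\prec x$, the slack of $(x,y)$ in $\mathcal C$ is $\ell_y-r_x-1$ if $x\prec y$, $r_y-\ell_x$ if $x\parallel y$, and $r_x-\ell_x$ if $x=y$. A pair with slack $0$ is a slack zero pair; it is a slack zero cover pair if $x\prec y$ and a slack zero sharp pair if $x\parallel y$. A matrix is totally unimodular if every square submatrix has determinant $0$, $1$ or $-1$. -}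

module Defs where

open import Data.Nat as ℕ using (ℕ; zero; suc; _<_; _≤_)
open import Data.Integer as ℤ using (ℤ; +_; _-_; -_)
open import Data.Fin as Fin using (Fin; _↑ˡ_; _↑ʳ_; punchIn)
open import Data.Fin.Properties as FinP using ()
open import Data.List using (List; []; _∷_; _++_; concatMap; allFin; length; lookup)
open import Data.Product using (Σ; ∃; _×_; _,_)
open import Data.Sum using (_⊎_)
open import Function.Definitions using (Injective)
open import Function.Bundles using (_⇔_)
open import Relation.Nullary using (Dec; yes; no; ¬_)
open import Relation.Nullary.Decidable using (_×-dec_; ¬?)
open import Relation.Binary.PropositionalEquality using (_≡_; _≢_)

Matrix : ℕ → ℕ → Set
Matrix m N = Fin m → Fin N → ℤ

Σℤ : ∀ k → (Fin k → ℤ) → ℤ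
Σℤ zero    f = + 0
Σℤ (suc k) f = f Fin.zero ℤ.+ Σℤ k (λ i → f (Fin.suc i))

sign : ℕ → ℤ
sign zero          = + 1
sign (suc zero)    = - (+ 1)
sign (suc (suc k)) = sign k

det : ∀ k → (Fin k → Fin k → ℤ) → ℤ
det zero    A = + 1
det (suc k) A =
  Σℤ (suc k) (λ j → sign (Fin.toℕ j) ℤ.* (A Fin.zero j ℤ.*
     det k (λ i j′ → A (Fin.suc i) (punchIn j j′))))

TotallyUnimodular : ∀ {m N} → Matrix m N → Set
TotallyUnimodular {m} {N} M =
  ∀ k (rs : Fin k → Fin m) (cs : Fin k → Fin N) →
  Injective _≡_ _≡_ rs → Injective _≡_ _≡_ cs →
  let d = det k (λ i j → M (rs i) (cs j)) in
  (d ≡ + 0) ⊎ (d ≡ + 1) ⊎ (d ≡ - (+ 1))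

fromRows : ∀ {N} (rows : List (Fin N → ℤ)) → Matrix (length rows) N
fromRows rows i = lookup rows i

module _ {n : ℕ} (_≺_ : Fin n → Fin n → Set) where

  IsIntervalRep : (ℓ r : Fin n → ℕ) → Set
  IsIntervalRep ℓ r = (∀ x → ℓ x ≤ r x) × (∀ x y → (x ≺ y) ⇔ (r x < ℓ y))

  IsEndpoint : (ℓ r : Fin n → ℕ) → ℕ → Set
  IsEndpoint ℓ r v = ∃ λ x → (v ≡ ℓ x) ⊎ (v ≡ r x)

  -- The canonical representation: an interval representation whose set of
  -- endpoints is exactly {0,…,m-1}, where m is the minimum number of distinct
  -- endpoints of any interval representation of the order.
  IsCanonicalRep : (ℓ r : Fin n → ℕ) → Set
  IsCanonicalRep ℓ r =
    IsIntervalRep ℓ r ×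
    Σ ℕ λ m →
      (∀ v → IsEndpoint ℓ r v ⇔ (v < m)) ×
      (∀ ℓ′ r′ → IsIntervalRep ℓ′ r′ →
        Σ (Fin m → ℕ) λ e → Injective _≡_ _≡_ e × (∀ i → IsEndpoint ℓ′ r′ (e i)))

  _∥_ : Fin n → Fin n → Set
  x ∥ y = (x ≢ y) × ¬ (x ≺ y) × ¬ (y ≺ x)

module _ {n : ℕ} {_≺_ : Fin n → Fin n → Set}
         (_≺?_ : ∀ x y → Dec (x ≺ y)) (ℓ r : Fin n → ℕ) where

  -- slack of (x,y) (meaningful when y ⊀ x; the remaining case is junk).
  slack : Fin n → Fin n → ℤ
  slack x y with x FinP.≟ y
  ... | yes _ = + r x - + ℓ x
  ... | no _ with x ≺? y
  ...   | yes _ = + ℓ y - + r x - + 1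
  ...   | no _  = + r y - + ℓ x

  SlackZeroCover : Fin n → Fin n → Set
  SlackZeroCover x y = (x ≺ y) × (slack x y ≡ + 0)

  SlackZeroSharp : Fin n → Fin n → Set
  SlackZeroSharp x y = (_∥_ _≺_ x y) × (slack x y ≡ + 0)

  SlackZeroDiag : Fin n → Set
  SlackZeroDiag x = slack x x ≡ + 0

  private
    when : ∀ {P : Set} {A : Set} → Dec P → A → List A
    when (yes _) a = a ∷ []
    when (no _)  a = []

    ∥? : ∀ x y → Dec (_∥_ _≺_ x y)
    ∥? x y = ¬? (x FinP.≟ y) ×-dec (¬? (x ≺? y) ×-dec ¬? (y ≺? x))

    pairs : (Fin n → Fin n → List (Fin (n ℕ.+ n) → ℤ)) → List (Fin (n ℕ.+ n) → ℤ)
    pairs f = concatMap (λ x → concatMap (λ y → f x y) (allFin n)) (allFin n)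

  colℓ colρ : Fin n → Fin (n ℕ.+ n)
  colℓ x = x ↑ˡ n
  colρ x = n ↑ʳ x

  δ : Fin (n ℕ.+ n) → Fin (n ℕ.+ n) → ℤ
  δ c d with c FinP.≟ d
  ... | yes _ = + 1
  ... | no _  = + 0

  coverRow : Fin n → Fin n → Fin (n ℕ.+ n) → ℤ
  coverRow x y c = δ c (colℓ x) ℤ.+ δ c (colρ x) - δ c (colℓ y)

  sharpRow : Fin n → Fin n → Fin (n ℕ.+ n) → ℤ
  sharpRow x y c = δ c (colℓ x) - δ c (colℓ y) - δ c (colρ y)

  diagRow : Fin n → Fin (n ℕ.+ n) → ℤ
  diagRow x c = - δ c (colρ x)

  leftRow : Fin n → Fin (n ℕ.+ n) → ℤ
  leftRow x c = - δ c (colℓ x)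

  rowsP : List (Fin (n ℕ.+ n) → ℤ)
  rowsP =
    pairs (λ x y → when ((x ≺? y) ×-dec (slack x y ℤ.≟ + 0)) (coverRow x y)) ++
    pairs (λ x y → when (∥? x y ×-dec (slack x y ℤ.≟ + 0)) (sharpRow x y)) ++
    concatMap (λ x → when (slack x x ℤ.≟ + 0) (diagRow x)) (allFin n) ++
    concatMap (λ x → leftRow x ∷ []) (allFin n)

  M_P : Matrix (length rowsP) (n ℕ.+ n)
  M_P = fromRows rowsP

{-# OPTIONS --safe #-}
-- Substituting r = ℓ + ρ turns every row of M_P into the difference of the coefficient vectors of two
-- "endpoints" among ℓₓ, rₓ (x ∈ [n]) and the constant 0, i.e. into a row of the incidence matrix of a
-- directed graph. On a square submatrix the substitution is a determinant-preserving column operation: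
-- subtract the column ρₓ from the column ℓₓ whenever both are selected. Afterwards every row has at most
-- one +1 and at most one -1, and such a matrix has determinant 0 or ±1 by expansion along the first row,
-- after adding the column of its -1 to the column of its +1 if both occur.
module Submission where

open import Defs
open import Data.Nat using (ℕ)
open import Data.Fin using (Fin)
open import Relation.Nullary using (Dec)

import Data.Integer.Properties as Int
open import Algebra.Properties.AbelianGroup Int.+-0-abelianGroup using (inverseˡ-unique)
open import Algebra.Properties.CommutativeSemigroup Int.+-commutativeSemigroup using (interchange)
open import Data.Bool using (if_then_else_)
open import Data.Fin using (zero; suc; toℕ; inject₁; punchIn; punchOut; fromℕ<; splitAt)
open import Data.Fin.Permutation.Components using (transpose)
import Data.Fin.Properties as Fin
open import Data.Integer as ℤ using (ℤ; +_; -_; _+_; _-_; _*_)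
open import Data.Integer.Tactic.RingSolver using (solve-∀)
open import Data.List using (List; _∷_; []; allFin; concatMap)
open import Data.List.Membership.Propositional using (_∈_)
open import Data.List.Membership.Propositional.Properties using (∈-++⁻; ∈-concatMap⁻; ∈-lookup)
open import Data.List.Relation.Unary.Any using (here; satisfied)
open import Data.Maybe using (Maybe; just; nothing; maybe)
open import Data.Nat using (zero; suc; _<_; _≤_; _<?_)
import Data.Nat as ℕ
import Data.Nat.Properties as ℕ
open import Data.Product using (Σ; ∃; _×_; _,_; proj₁; proj₂)
open import Data.Sum using (_⊎_; inj₁; inj₂)
open import Function using (_∘_)
open import Function.Definitions using (Injective)
open import Relation.Binary.Definitions using (tri<; tri≈; tri>)
open import Relation.Binary.PropositionalEquality
open import Relation.Nullary using (¬_; yes; no; does; contradiction)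
open import Relation.Nullary.Decidable using (dec-true; dec-false)

open ≡-Reasoning

Σℤ-cong : ∀ k {f g : Fin k → ℤ} → (∀ j → f j ≡ g j) → Σℤ k f ≡ Σℤ k g
Σℤ-cong zero    f≗g = refl
Σℤ-cong (suc k) f≗g = cong₂ _+_ (f≗g zero) (Σℤ-cong k (f≗g ∘ suc))

Σℤ-+ : ∀ k (f g : Fin k → ℤ) → Σℤ k (λ j → f j + g j) ≡ Σℤ k f + Σℤ k g
Σℤ-+ zero    f g = refl
Σℤ-+ (suc k) f g = trans (cong (_+_ (f zero + g zero)) (Σℤ-+ k (f ∘ suc) (g ∘ suc)))
                         (interchange (f zero) (g zero) (Σℤ k (f ∘ suc)) (Σℤ k (g ∘ suc)))

Σℤ-zero : ∀ k (f : Fin k → ℤ) → (∀ j → f j ≡ + 0) → Σℤ k f ≡ + 0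
Σℤ-zero zero    f f≗0 = refl
Σℤ-zero (suc k) f f≗0 = cong₂ _+_ (f≗0 zero) (Σℤ-zero k (f ∘ suc) (f≗0 ∘ suc))

Σℤ-single : ∀ k (f : Fin k → ℤ) p → (∀ j → j ≢ p → f j ≡ + 0) → Σℤ k f ≡ f p
Σℤ-single (suc k) f zero    f≗0 = begin
  f zero + Σℤ k (f ∘ suc)  ≡⟨ cong (_+_ (f zero)) (Σℤ-zero k (f ∘ suc) (λ j → f≗0 (suc j) (Fin.0≢1+n ∘ sym))) ⟩
  f zero + + 0             ≡⟨ Int.+-identityʳ (f zero) ⟩
  f zero                   ∎
Σℤ-single (suc k) f (suc p) f≗0 = begin
  f zero + Σℤ k (f ∘ suc)  ≡⟨ cong (_+ Σℤ k (f ∘ suc)) (f≗0 zero Fin.0≢1+n) ⟩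
  + 0 + Σℤ k (f ∘ suc)     ≡⟨ Int.+-identityˡ _ ⟩
  Σℤ k (f ∘ suc)           ≡⟨ Σℤ-single k (f ∘ suc) p (λ j j≢p → f≗0 (suc j) (j≢p ∘ Fin.suc-injective)) ⟩
  f (suc p)                ∎

Σℤ-pair : ∀ k (f : Fin k → ℤ) {a b} → a ≢ b → (∀ j → j ≢ a → j ≢ b → f j ≡ + 0) →
          Σℤ k f ≡ f a + f b
Σℤ-pair (suc k) f {zero}  {zero}  a≢b f≗0 = contradiction refl a≢b
Σℤ-pair (suc k) f {zero}  {suc b} a≢b f≗0 = cong (_+_ (f zero)) (Σℤ-single k (f ∘ suc) b λ j j≢b →
  f≗0 (suc j) (Fin.0≢1+n ∘ sym) (j≢b ∘ Fin.suc-injective))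
Σℤ-pair (suc k) f {suc a} {zero}  a≢b f≗0 = begin
  f zero + Σℤ k (f ∘ suc)  ≡⟨ cong (_+_ (f zero)) (Σℤ-single k (f ∘ suc) a λ j j≢a →
                                f≗0 (suc j) (j≢a ∘ Fin.suc-injective) (Fin.0≢1+n ∘ sym)) ⟩
  f zero + f (suc a)       ≡⟨ Int.+-comm (f zero) (f (suc a)) ⟩
  f (suc a) + f zero       ∎
Σℤ-pair (suc k) f {suc a} {suc b} a≢b f≗0 = begin
  f zero + Σℤ k (f ∘ suc)  ≡⟨ cong (_+ Σℤ k (f ∘ suc)) (f≗0 zero Fin.0≢1+n Fin.0≢1+n) ⟩
  + 0 + Σℤ k (f ∘ suc)     ≡⟨ Int.+-identityˡ _ ⟩
  Σℤ k (f ∘ suc)           ≡⟨ Σℤ-pair k (f ∘ suc) (a≢b ∘ cong suc)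
                                (λ j j≢a j≢b → f≗0 (suc j) (j≢a ∘ Fin.suc-injective) (j≢b ∘ Fin.suc-injective)) ⟩
  f (suc a) + f (suc b)    ∎

minor : ∀ {k} → Matrix (suc k) (suc k) → Fin (suc k) → Matrix k k
minor A j i j′ = A (suc i) (punchIn j j′)

laplaceTerm : ∀ k → Matrix (suc k) (suc k) → Fin (suc k) → ℤ
laplaceTerm k A j = sign (toℕ j) * (A zero j * det k (minor A j))

det-cong : ∀ k {A B : Matrix k k} → (∀ i j → A i j ≡ B i j) → det k A ≡ det k B
det-cong zero    A≗B = refl
det-cong (suc k) A≗B = Σℤ-cong (suc k) λ j →
  cong₂ (λ a d → sign (toℕ j) * (a * d)) (A≗B zero j) (det-cong k λ i j′ → A≗B (suc i) (punchIn j j′))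

det-single : ∀ k (A : Matrix (suc k) (suc k)) p → (∀ j → j ≢ p → A zero j ≡ + 0) →
             det (suc k) A ≡ laplaceTerm k A p
det-single k A p A₀≗0 = Σℤ-single (suc k) (laplaceTerm k A) p λ j j≢p →
  trans (cong (λ a → sign (toℕ j) * (a * det k (minor A j))) (A₀≗0 j j≢p)) (Int.*-zeroʳ (sign (toℕ j)))

punchIn≢punchOut : ∀ {k} {j c : Fin (suc k)} (j≢c : j ≢ c) {j′} → j′ ≢ punchOut j≢c → punchIn j j′ ≢ c
punchIn≢punchOut {j = j} j≢c {j′} j′≢ eq =
  j′≢ (Fin.punchIn-injective j j′ _ (trans eq (sym (Fin.punchIn-punchOut j≢c))))

det-+-column : ∀ k (A B C : Matrix k k) c → (∀ i → A i c ≡ B i c + C i c) →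
               (∀ i j → j ≢ c → A i j ≡ B i j) → (∀ i j → j ≢ c → A i j ≡ C i j) →
               det k A ≡ det k B + det k C
det-+-column (suc k) A B C c A≡B+C A≗B A≗C =
  trans (Σℤ-cong (suc k) term-+) (Σℤ-+ (suc k) (laplaceTerm k B) (laplaceTerm k C))
  where
  distribʳ : ∀ s a b d → s * ((a + b) * d) ≡ s * (a * d) + s * (b * d)
  distribʳ = solve-∀
  distribˡ : ∀ s a d e → s * (a * (d + e)) ≡ s * (a * d) + s * (a * e)
  distribˡ = solve-∀
  term-+ : ∀ j → laplaceTerm k A j ≡ laplaceTerm k B j + laplaceTerm k C j
  term-+ j with j Fin.≟ c
  ... | yes refl = begin
    sign (toℕ j) * (A zero j * det k (minor A j))
      ≡⟨ cong₂ (λ a d → sign (toℕ j) * (a * d)) (A≡B+C zero) (det-cong k minorA≗minorB) ⟩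
    sign (toℕ j) * ((B zero j + C zero j) * det k (minor B j))
      ≡⟨ distribʳ (sign (toℕ j)) (B zero j) (C zero j) (det k (minor B j)) ⟩
    laplaceTerm k B j + sign (toℕ j) * (C zero j * det k (minor B j))
      ≡⟨ cong (λ d → laplaceTerm k B j + sign (toℕ j) * (C zero j * d))
              (det-cong k λ i j′ → trans (sym (minorA≗minorB i j′)) (A≗C (suc i) _ (Fin.punchInᵢ≢i j j′))) ⟩
    laplaceTerm k B j + laplaceTerm k C j ∎
    where
    minorA≗minorB : ∀ i j′ → minor A j i j′ ≡ minor B j i j′
    minorA≗minorB i j′ = A≗B (suc i) _ (Fin.punchInᵢ≢i j j′)
  ... | no j≢c = begin
    sign (toℕ j) * (A zero j * det k (minor A j))
      ≡⟨ cong₂ (λ a d → sign (toℕ j) * (a * d)) (A≗B zero j j≢c) minor-+ ⟩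
    sign (toℕ j) * (B zero j * (det k (minor B j) + det k (minor C j)))
      ≡⟨ distribˡ (sign (toℕ j)) (B zero j) (det k (minor B j)) (det k (minor C j)) ⟩
    laplaceTerm k B j + sign (toℕ j) * (B zero j * det k (minor C j))
      ≡⟨ cong (λ a → laplaceTerm k B j + sign (toℕ j) * (a * det k (minor C j)))
              (trans (sym (A≗B zero j j≢c)) (A≗C zero j j≢c)) ⟩
    laplaceTerm k B j + laplaceTerm k C j ∎
    where
    minor-+ : det k (minor A j) ≡ det k (minor B j) + det k (minor C j)
    minor-+ = det-+-column k (minor A j) (minor B j) (minor C j) (punchOut j≢c)
      (λ i → subst (λ c → A (suc i) c ≡ B (suc i) c + C (suc i) c)
                   (sym (Fin.punchIn-punchOut j≢c)) (A≡B+C (suc i)))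
      (λ i j′ j′≢c′ → A≗B (suc i) _ (punchIn≢punchOut j≢c j′≢c′))
      (λ i j′ j′≢c′ → A≗C (suc i) _ (punchIn≢punchOut j≢c j′≢c′))

record SwapsAdjacent {m k} (t : Fin k) (A B : Matrix m (suc k)) : Set where
  field
    at-left   : ∀ i → B i (inject₁ t) ≡ A i (suc t)
    at-right  : ∀ i → B i (suc t) ≡ A i (inject₁ t)
    elsewhere : ∀ i j → j ≢ inject₁ t → j ≢ suc t → B i j ≡ A i j

inject₁≢suc : ∀ {k} (t : Fin k) → inject₁ t ≢ suc t
inject₁≢suc zero    ()
inject₁≢suc (suc t) = inject₁≢suc t ∘ Fin.suc-injective

sign-suc : ∀ m → sign (suc m) ≡ - sign m
sign-suc zero          = refl
sign-suc (suc zero)    = refl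
sign-suc (suc (suc m)) = sign-suc m

punchIn-adjacent : ∀ {k} (j : Fin (suc (suc k))) (t : Fin (suc k)) → j ≢ inject₁ t → j ≢ suc t →
  Σ (Fin k) λ t′ → punchIn j (inject₁ t′) ≡ inject₁ t × punchIn j (suc t′) ≡ suc t
punchIn-adjacent zero          zero    j≢t _     = contradiction refl j≢t
punchIn-adjacent zero          (suc t) _   _     = t , refl , refl
punchIn-adjacent (suc zero)    zero    _   j≢t+1 = contradiction refl j≢t+1
punchIn-adjacent {suc k} (suc (suc j)) zero _ _  = zero , refl , refl
punchIn-adjacent {suc k} (suc j) (suc t) j≢t j≢t+1
  with t′ , eq₁ , eq₂ ← punchIn-adjacent j t (j≢t ∘ cong suc) (j≢t+1 ∘ cong suc)
  = suc t′ , cong suc eq₁ , cong suc eq₂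

punchIn-inject₁-suc : ∀ {k} (t j′ : Fin k) →
  (punchIn (inject₁ t) j′ ≡ punchIn (suc t) j′ × punchIn (suc t) j′ ≢ inject₁ t × punchIn (suc t) j′ ≢ suc t) ⊎
  (punchIn (inject₁ t) j′ ≡ suc t × punchIn (suc t) j′ ≡ inject₁ t)
punchIn-inject₁-suc zero    zero     = inj₂ (refl , refl)
punchIn-inject₁-suc zero    (suc j′) = inj₁ (refl , (λ ()) , (λ ()))
punchIn-inject₁-suc (suc t) zero     = inj₁ (refl , (λ ()) , (λ ()))
punchIn-inject₁-suc (suc t) (suc j′) with punchIn-inject₁-suc t j′
... | inj₁ (eq , ≢t , ≢t+1) = inj₁ (cong suc eq , ≢t ∘ Fin.suc-injective , ≢t+1 ∘ Fin.suc-injective)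
... | inj₂ (eq₁ , eq₂)      = inj₂ (cong suc eq₁ , cong suc eq₂)

module _ {k} {A B : Matrix (suc (suc k)) (suc (suc k))} {t : Fin (suc k)}
         (swapped : SwapsAdjacent t A B) where
  open SwapsAdjacent swapped

  minor-SwapsAdjacent : ∀ j → j ≢ inject₁ t → j ≢ suc t →
                        Σ (Fin k) λ t′ → SwapsAdjacent t′ (minor A j) (minor B j)
  minor-SwapsAdjacent j j≢t j≢t+1 with t′ , eq₁ , eq₂ ← punchIn-adjacent j t j≢t j≢t+1 = t′ , record
    { at-left   = λ i → trans (cong (B (suc i)) eq₁) (trans (at-left (suc i)) (cong (A (suc i)) (sym eq₂)))
    ; at-right  = λ i → trans (cong (B (suc i)) eq₂) (trans (at-right (suc i)) (cong (A (suc i)) (sym eq₁)))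
    ; elsewhere = λ i j′ j′≢t′ j′≢t′+1 → elsewhere (suc i) (punchIn j j′)
        (j′≢t′ ∘ Fin.punchIn-injective j j′ (inject₁ t′) ∘ (λ eq → trans eq (sym eq₁)))
        (j′≢t′+1 ∘ Fin.punchIn-injective j j′ (suc t′) ∘ (λ eq → trans eq (sym eq₂)))
    }

  minor-at-left : ∀ i j′ → minor B (inject₁ t) i j′ ≡ minor A (suc t) i j′
  minor-at-left i j′ with punchIn-inject₁-suc t j′
  ... | inj₁ (eq , ≢t , ≢t+1) = trans (cong (B (suc i)) eq) (elsewhere (suc i) _ ≢t ≢t+1)
  ... | inj₂ (eq₁ , eq₂)      =
    trans (cong (B (suc i)) eq₁) (trans (at-right (suc i)) (cong (A (suc i)) (sym eq₂)))

  minor-at-right : ∀ i j′ → minor B (suc t) i j′ ≡ minor A (inject₁ t) i j′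
  minor-at-right i j′ with punchIn-inject₁-suc t j′
  ... | inj₁ (eq , ≢t , ≢t+1) = trans (elsewhere (suc i) _ ≢t ≢t+1) (cong (A (suc i)) (sym eq))
  ... | inj₂ (eq₁ , eq₂)      =
    trans (cong (B (suc i)) eq₂) (trans (at-left (suc i)) (cong (A (suc i)) (sym eq₁)))

  laplaceTerms-cancel-at-swap :
    laplaceTerm (suc k) B (inject₁ t) + laplaceTerm (suc k) A (inject₁ t)
      + (laplaceTerm (suc k) B (suc t) + laplaceTerm (suc k) A (suc t)) ≡ + 0
  laplaceTerms-cancel-at-swap = begin
    s * (B zero (inject₁ t) * det (suc k) (minor B (inject₁ t))) + s * x
      + (sign (toℕ (suc t)) * (B zero (suc t) * det (suc k) (minor B (suc t))) + sign (toℕ (suc t)) * y)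
      ≡⟨ cong₂ (λ u v → u + s * x + (v + sign (toℕ (suc t)) * y))
               (cong₂ (λ a d → s * (a * d)) (at-left zero) (det-cong (suc k) minor-at-left))
               (cong₂ (λ a d → sign (toℕ (suc t)) * (a * d)) (at-right zero)
                      (det-cong (suc k) minor-at-right)) ⟩
    s * y + s * x + (sign (toℕ (suc t)) * x + sign (toℕ (suc t)) * y)
      ≡⟨ cong (λ s′ → s * y + s * x + (s′ * x + s′ * y)) sign-t+1 ⟩
    s * y + s * x + (- s * x + - s * y)
      ≡⟨ cancel s x y ⟩
    + 0 ∎
    where
    s x y : ℤ
    s = sign (toℕ (inject₁ t))
    x = A zero (inject₁ t) * det (suc k) (minor A (inject₁ t))
    y = A zero (suc t) * det (suc k) (minor A (suc t))
    sign-t+1 : sign (toℕ (suc t)) ≡ - s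
    sign-t+1 = trans (sign-suc (toℕ t)) (cong (-_ ∘ sign) (sym (Fin.toℕ-inject₁ t)))
    cancel : ∀ s x y → s * y + s * x + (- s * x + - s * y) ≡ + 0
    cancel = solve-∀

det-swap : ∀ k {A B : Matrix (suc k) (suc k)} {t : Fin k} → SwapsAdjacent t A B →
           det (suc k) B ≡ - det (suc k) A
det-swap (suc k) {A} {B} {t} swapped = inverseˡ-unique (det (2 ℕ.+ k) B) (det (2 ℕ.+ k) A) (begin
  det (2 ℕ.+ k) B + det (2 ℕ.+ k) A  ≡⟨ Σℤ-+ (2 ℕ.+ k) (laplaceTerm (suc k) B) (laplaceTerm (suc k) A) ⟨
  Σℤ (2 ℕ.+ k) g                     ≡⟨ Σℤ-pair (2 ℕ.+ k) g (inject₁≢suc t) g-elsewhere ⟩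
  g (inject₁ t) + g (suc t)          ≡⟨ laplaceTerms-cancel-at-swap swapped ⟩
  + 0                                ∎)
  where
  open SwapsAdjacent swapped
  g : Fin (suc (suc k)) → ℤ
  g j = laplaceTerm (suc k) B j + laplaceTerm (suc k) A j
  cancel : ∀ s a d → s * (a * - d) + s * (a * d) ≡ + 0
  cancel = solve-∀
  g-elsewhere : ∀ j → j ≢ inject₁ t → j ≢ suc t → g j ≡ + 0
  g-elsewhere j j≢t j≢t+1 with t′ , minor-swapped ← minor-SwapsAdjacent swapped j j≢t j≢t+1 = begin
    sign (toℕ j) * (B zero j * det (suc k) (minor B j)) + laplaceTerm (suc k) A j
      ≡⟨ cong₂ (λ a d → sign (toℕ j) * (a * d) + laplaceTerm (suc k) A j)
               (elsewhere zero j j≢t j≢t+1) (det-swap k minor-swapped) ⟩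
    sign (toℕ j) * (A zero j * - det (suc k) (minor A j)) + laplaceTerm (suc k) A j
      ≡⟨ cancel (sign (toℕ j)) (A zero j) (det (suc k) (minor A j)) ⟩
    + 0 ∎

transpose-matchˡ : ∀ {m} (i j : Fin m) → transpose i j i ≡ j
transpose-matchˡ i j rewrite dec-true (i Fin.≟ i) refl = refl

transpose-matchʳ : ∀ {m} {i j : Fin m} → i ≢ j → transpose i j j ≡ i
transpose-matchʳ {i = i} {j} i≢j
  rewrite dec-false (j Fin.≟ i) (i≢j ∘ sym) | dec-true (j Fin.≟ j) refl = refl

transpose-other : ∀ {m} {i j l : Fin m} → l ≢ i → l ≢ j → transpose i j l ≡ l
transpose-other {i = i} {j} {l} l≢i l≢j
  rewrite dec-false (l Fin.≟ i) l≢i | dec-false (l Fin.≟ j) l≢j = refl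

transpose-SwapsAdjacent : ∀ {m k} (t : Fin k) (A : Matrix m (suc k)) →
                          SwapsAdjacent t A (λ i j → A i (transpose (inject₁ t) (suc t) j))
transpose-SwapsAdjacent t A = record
  { at-left   = λ i → cong (A i) (transpose-matchˡ (inject₁ t) (suc t))
  ; at-right  = λ i → cong (A i) (transpose-matchʳ (inject₁≢suc t))
  ; elsewhere = λ i j j≢t j≢t+1 → cong (A i) (transpose-other j≢t j≢t+1)
  }

i≡-i⇒i≡0 : ∀ {i} → i ≡ - i → i ≡ + 0
i≡-i⇒i≡0 {+ zero}    _ = refl
i≡-i⇒i≡0 {+ suc _}   ()
i≡-i⇒i≡0 {ℤ.-[1+ _ ]} ()

-- Induction on the distance d: swapping the column b = t + 1 with its left neighbour t
-- brings the two equal columns one step closer.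
det-equal-columns-apart : ∀ d k (A : Matrix k k) {a b} → toℕ b ≡ suc (toℕ a ℕ.+ d) →
                          (∀ i → A i a ≡ A i b) → det k A ≡ + 0
det-equal-columns-apart d       (suc k) A {b = zero}  ()
det-equal-columns-apart zero    (suc k) A {a} {suc t} b≡ a≗b = i≡-i⇒i≡0 (det-swap k {A} {A} {t} record
  { at-left   = λ i → trans (cong (A i) (sym a≡t)) (a≗b i)
  ; at-right  = λ i → trans (sym (a≗b i)) (cong (A i) a≡t)
  ; elsewhere = λ _ _ _ _ → refl
  })
  where
  a≡t : a ≡ inject₁ t
  a≡t = Fin.toℕ-injective (begin
    toℕ a             ≡⟨ ℕ.+-identityʳ (toℕ a) ⟨
    toℕ a ℕ.+ 0       ≡⟨ ℕ.suc-injective b≡ ⟨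
    toℕ t             ≡⟨ Fin.toℕ-inject₁ t ⟨
    toℕ (inject₁ t)   ∎)
det-equal-columns-apart (suc d) (suc k) A {a} {suc t} b≡ a≗b = begin
  det (suc k) A     ≡⟨ Int.neg-involutive _ ⟨
  - - det (suc k) A ≡⟨ cong -_ (det-swap k (transpose-SwapsAdjacent t A)) ⟨
  - det (suc k) B   ≡⟨ cong -_ (det-equal-columns-apart d (suc k) B t≡ a≗t) ⟩
  + 0               ∎
  where
  B : Matrix (suc k) (suc k)
  B i j = A i (transpose (inject₁ t) (suc t) j)
  t≡ : toℕ (inject₁ t) ≡ suc (toℕ a ℕ.+ d)
  t≡ = trans (Fin.toℕ-inject₁ t) (trans (ℕ.suc-injective b≡) (ℕ.+-suc (toℕ a) d))
  a≗t : ∀ i → B i a ≡ B i (inject₁ t)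
  a≗t i = begin
    A i (transpose (inject₁ t) (suc t) a)
      ≡⟨ cong (A i) (transpose-other (ℕ.m≢1+m+n (toℕ a) ∘ (λ eq → trans (cong toℕ eq) t≡))
                                     (ℕ.m≢1+m+n (toℕ a) ∘ (λ eq → trans (cong toℕ eq) b≡))) ⟩
    A i a
      ≡⟨ a≗b i ⟩
    A i (suc t)
      ≡⟨ cong (A i) (transpose-matchˡ (inject₁ t) (suc t)) ⟨
    A i (transpose (inject₁ t) (suc t) (inject₁ t)) ∎

det-equal-columns : ∀ k (A : Matrix k k) {a b} → a ≢ b → (∀ i → A i a ≡ A i b) → det k A ≡ + 0
det-equal-columns k A {a} {b} a≢b a≗b with ℕ.<-cmp (toℕ a) (toℕ b)
... | tri< a<b _ _ = let d , eq = ℕ.m≤n⇒∃[o]m+o≡n a<b in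
                     det-equal-columns-apart d k A (sym eq) a≗b
... | tri≈ _ eq _  = contradiction (Fin.toℕ-injective eq) a≢b
... | tri> _ _ b<a = let d , eq = ℕ.m≤n⇒∃[o]m+o≡n b<a in
                     det-equal-columns-apart d k A (sym eq) (sym ∘ a≗b)

det-subtract-column : ∀ k (A A′ : Matrix k k) {c e} → c ≢ e →
  (∀ i → A′ i c ≡ A i c - A i e) → (∀ i j → j ≢ c → A′ i j ≡ A i j) → det k A′ ≡ det k A
det-subtract-column k A A′ {c} {e} c≢e A′-at-c A′-elsewhere = sym (begin
  det k A             ≡⟨ det-+-column k A A′ C c A≡A′+C (λ i j j≢c → sym (A′-elsewhere i j j≢c))
                                                      (λ i j j≢c → sym (C-elsewhere i j j≢c)) ⟩
  det k A′ + det k C  ≡⟨ cong (_+_ (det k A′)) (det-equal-columns k C c≢e C-c≡C-e) ⟩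
  det k A′ + + 0      ≡⟨ Int.+-identityʳ (det k A′) ⟩
  det k A′            ∎)
  where
  C : Matrix k k
  C i j = if does (j Fin.≟ c) then A i e else A i j
  C-at-c : ∀ i → C i c ≡ A i e
  C-at-c i rewrite dec-true (c Fin.≟ c) refl = refl
  C-elsewhere : ∀ i j → j ≢ c → C i j ≡ A i j
  C-elsewhere i j j≢c rewrite dec-false (j Fin.≟ c) j≢c = refl
  C-c≡C-e : ∀ i → C i c ≡ C i e
  C-c≡C-e i = trans (C-at-c i) (sym (C-elsewhere i e (c≢e ∘ sym)))
  minus-plus : ∀ x y → x ≡ x - y + y
  minus-plus = solve-∀
  A≡A′+C : ∀ i → A i c ≡ A′ i c + C i c
  A≡A′+C i = trans (minus-plus (A i c) (A i e)) (sym (cong₂ _+_ (A′-at-c i) (C-at-c i)))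

UnitOrZero : ℤ → Set
UnitOrZero z = z ≡ + 0 ⊎ z ≡ + 1 ⊎ z ≡ - (+ 1)

UnitOrZero-* : ∀ {x y} → UnitOrZero x → UnitOrZero y → UnitOrZero (x * y)
UnitOrZero-* (inj₁ refl)        _                  = inj₁ refl
UnitOrZero-* (inj₂ (inj₁ refl)) y                  = subst UnitOrZero (sym (Int.*-identityˡ _)) y
UnitOrZero-* (inj₂ (inj₂ refl)) (inj₁ refl)        = inj₁ refl
UnitOrZero-* (inj₂ (inj₂ refl)) (inj₂ (inj₁ refl)) = inj₂ (inj₂ refl)
UnitOrZero-* (inj₂ (inj₂ refl)) (inj₂ (inj₂ refl)) = inj₂ (inj₁ refl)

sign-UnitOrZero : ∀ m → UnitOrZero (sign m)
sign-UnitOrZero zero          = inj₂ (inj₁ refl)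
sign-UnitOrZero (suc zero)    = inj₂ (inj₂ refl)
sign-UnitOrZero (suc (suc m)) = sign-UnitOrZero m

UnitOrZero-+ : ∀ {a b} → UnitOrZero a → UnitOrZero b →
               ¬ (a ≡ + 1 × b ≡ + 1) → ¬ (a ≡ - (+ 1) × b ≡ - (+ 1)) →
               UnitOrZero (a + b) × (∀ {s} → s ≢ + 0 → a + b ≡ s → a ≡ s ⊎ b ≡ s)
UnitOrZero-+ (inj₁ refl)        (inj₁ refl)        _ _ = inj₁ refl , λ s≢0 eq → contradiction (sym eq) s≢0
UnitOrZero-+ (inj₁ refl)        (inj₂ (inj₁ refl)) _ _ = inj₂ (inj₁ refl) , λ _ → inj₂
UnitOrZero-+ (inj₁ refl)        (inj₂ (inj₂ refl)) _ _ = inj₂ (inj₂ refl) , λ _ → inj₂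
UnitOrZero-+ (inj₂ (inj₁ refl)) (inj₁ refl)        _ _ = inj₂ (inj₁ refl) , λ _ → inj₁
UnitOrZero-+ (inj₂ (inj₁ refl)) (inj₂ (inj₁ refl)) ¬both _ = contradiction (refl , refl) ¬both
UnitOrZero-+ (inj₂ (inj₁ refl)) (inj₂ (inj₂ refl)) _ _ = inj₁ refl , λ s≢0 eq → contradiction (sym eq) s≢0
UnitOrZero-+ (inj₂ (inj₂ refl)) (inj₁ refl)        _ _ = inj₂ (inj₂ refl) , λ _ → inj₁
UnitOrZero-+ (inj₂ (inj₂ refl)) (inj₂ (inj₁ refl)) _ _ = inj₁ refl , λ s≢0 eq → contradiction (sym eq) s≢0
UnitOrZero-+ (inj₂ (inj₂ refl)) (inj₂ (inj₂ refl)) _ ¬both = contradiction (refl , refl) ¬both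

AtMostOne : ∀ {k} → (Fin k → Set) → Set
AtMostOne P = ∀ j j′ → P j → P j′ → j ≡ j′

record IncidenceRow {k} (v : Fin k → ℤ) : Set where
  field
    entries      : ∀ j → UnitOrZero (v j)
    plus-unique  : AtMostOne (λ j → v j ≡ + 1)
    minus-unique : AtMostOne (λ j → v j ≡ - (+ 1))

  vanishes : ∀ j → v j ≢ + 1 → v j ≢ - (+ 1) → v j ≡ + 0
  vanishes j ≢1 ≢-1 with entries j
  ... | inj₁ vj≡0         = vj≡0
  ... | inj₂ (inj₁ vj≡1)  = contradiction vj≡1 ≢1
  ... | inj₂ (inj₂ vj≡-1) = contradiction vj≡-1 ≢-1

IncidenceRow-∘ : ∀ {k k′} {v : Fin k → ℤ} {f : Fin k′ → Fin k} →
                 Injective _≡_ _≡_ f → IncidenceRow v → IncidenceRow (v ∘ f)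
IncidenceRow-∘ {f = f} f-inj row = record
  { entries      = entries ∘ f
  ; plus-unique  = λ j j′ eq eq′ → f-inj (plus-unique (f j) (f j′) eq eq′)
  ; minus-unique = λ j j′ eq eq′ → f-inj (minus-unique (f j) (f j′) eq eq′)
  }
  where open IncidenceRow row

IncidenceRow-cong : ∀ {k} {v w : Fin k → ℤ} → (∀ j → v j ≡ w j) → IncidenceRow v → IncidenceRow w
IncidenceRow-cong v≗w row = record
  { entries      = λ j → subst UnitOrZero (v≗w j) (entries j)
  ; plus-unique  = λ j j′ eq eq′ → plus-unique j j′ (trans (v≗w j) eq) (trans (v≗w j′) eq′)
  ; minus-unique = λ j j′ eq eq′ → minus-unique j j′ (trans (v≗w j) eq) (trans (v≗w j′) eq′)
  }
  where open IncidenceRow row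

mergeColumn : ∀ {k} → Fin k → Fin k → (Fin k → ℤ) → Fin k → ℤ
mergeColumn p q v j with j Fin.≟ p
... | yes _ = v p + v q
... | no _  = v j

mergeColumn-at : ∀ {k} (p q : Fin k) (v : Fin k → ℤ) → mergeColumn p q v p ≡ v p + v q
mergeColumn-at p q v with p Fin.≟ p
... | yes _  = refl
... | no p≢p = contradiction refl p≢p

mergeColumn-elsewhere : ∀ {k} {p q j : Fin k} (v : Fin k → ℤ) → j ≢ p → mergeColumn p q v j ≡ v j
mergeColumn-elsewhere {p = p} {j = j} v j≢p with j Fin.≟ p
... | yes j≡p = contradiction j≡p j≢p
... | no _    = refl

module _ {k} {v : Fin (suc k) → ℤ} (row : IncidenceRow v) {p q : Fin (suc k)} (p≢q : p ≢ q) where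
  open IncidenceRow row

  private
    sum-p-q : UnitOrZero (v p + v q) × (∀ {s} → s ≢ + 0 → v p + v q ≡ s → v p ≡ s ⊎ v q ≡ s)
    sum-p-q = UnitOrZero-+ (entries p) (entries q)
      (λ (vp , vq) → p≢q (plus-unique p q vp vq)) (λ (vp , vq) → p≢q (minus-unique p q vp vq))

  mergeColumn-source : ∀ {s} → s ≢ + 0 → ∀ c → mergeColumn p q v c ≡ s →
                       v c ≡ s ⊎ (v q ≡ s × c ≡ p)
  mergeColumn-source s≢0 c eq with c Fin.≟ p
  ... | no _ = inj₁ eq
  ... | yes refl with proj₂ sum-p-q s≢0 eq
  ...   | inj₁ vp≡s = inj₁ vp≡s
  ...   | inj₂ vq≡s = inj₂ (vq≡s , refl)

  AtMostOne-merge : ∀ {s} → s ≢ + 0 → AtMostOne (λ j → v j ≡ s) →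
                    AtMostOne (λ j → mergeColumn p q v (punchIn q j) ≡ s)
  AtMostOne-merge {s} s≢0 unique j j′ eq eq′ =
    Fin.punchIn-injective q j j′ (same (Fin.punchInᵢ≢i q j) (Fin.punchInᵢ≢i q j′)
                                       (mergeColumn-source s≢0 _ eq) (mergeColumn-source s≢0 _ eq′))
    where
    same : ∀ {c c′} → c ≢ q → c′ ≢ q →
           v c ≡ s ⊎ (v q ≡ s × c ≡ p) → v c′ ≡ s ⊎ (v q ≡ s × c′ ≡ p) → c ≡ c′
    same _   _    (inj₁ vc≡s)       (inj₁ vc′≡s)       = unique _ _ vc≡s vc′≡s
    same c≢q _    (inj₁ vc≡s)       (inj₂ (vq≡s , _))  = contradiction (unique _ _ vc≡s vq≡s) c≢q
    same _   c′≢q (inj₂ (vq≡s , _)) (inj₁ vc′≡s)       = contradiction (unique _ _ vc′≡s vq≡s) c′≢q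
    same _   _    (inj₂ (_ , c≡p))  (inj₂ (_ , c′≡p))  = trans c≡p (sym c′≡p)

  IncidenceRow-merge : IncidenceRow (λ j → mergeColumn p q v (punchIn q j))
  IncidenceRow-merge = record
    { entries      = merged-entries ∘ punchIn q
    ; plus-unique  = AtMostOne-merge (λ ()) plus-unique
    ; minus-unique = AtMostOne-merge (λ ()) minus-unique
    }
    where
    merged-entries : ∀ c → UnitOrZero (mergeColumn p q v c)
    merged-entries c with c Fin.≟ p
    ... | yes refl = proj₁ sum-p-q
    ... | no _     = entries c

det-mergeColumn : ∀ k (A : Matrix k k) {p q} → p ≢ q → det k (λ i → mergeColumn p q (A i)) ≡ det k A
det-mergeColumn k A {p} {q} p≢q = sym (det-subtract-column k (λ i → mergeColumn p q (A i)) A p≢q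
  (λ i → trans (add-sub (A i p) (A i q))
               (sym (cong₂ _-_ (mergeColumn-at p q (A i)) (mergeColumn-elsewhere (A i) (p≢q ∘ sym)))))
  (λ i j j≢p → sym (mergeColumn-elsewhere (A i) j≢p)))
  where
  add-sub : ∀ x y → x ≡ x + y - y
  add-sub = solve-∀

det-by-single-entry : ∀ k (A : Matrix (suc k) (suc k)) p → (∀ j → j ≢ p → A zero j ≡ + 0) →
                      UnitOrZero (A zero p) → UnitOrZero (det k (minor A p)) → UnitOrZero (det (suc k) A)
det-by-single-entry k A p A₀≗0 entry minor-det = subst UnitOrZero (sym (det-single k A p A₀≗0))
  (UnitOrZero-* (sign-UnitOrZero (toℕ p)) (UnitOrZero-* entry minor-det))

det-incidence : ∀ k (A : Matrix k k) → (∀ i → IncidenceRow (A i)) → UnitOrZero (det k A)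
det-incidence zero    A rows = inj₂ (inj₁ refl)
det-incidence (suc k) A rows =
  by-first-row (Fin.any? (λ j → A zero j ℤ.≟ + 1)) (Fin.any? (λ j → A zero j ℤ.≟ - (+ 1)))
  where
  open IncidenceRow (rows zero)
  expand-at : ∀ p → (∀ j → j ≢ p → A zero j ≡ + 0) → UnitOrZero (det (suc k) A)
  expand-at p A₀≗0 = det-by-single-entry k A p A₀≗0 (entries p)
    (det-incidence k (minor A p) (λ i → IncidenceRow-∘ (Fin.punchIn-injective p _ _) (rows (suc i))))
  -- Adding column q to column p clears the +1 at p, leaving the -1 at q alone in the first row.
  merge-and-expand : ∀ {p q} → A zero p ≡ + 1 → A zero q ≡ - (+ 1) → UnitOrZero (det (suc k) A)
  merge-and-expand {p} {q} A₀p≡1 A₀q≡-1 = subst UnitOrZero (det-mergeColumn (suc k) A p≢q)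
    (det-by-single-entry k M q M₀≗0
      (subst UnitOrZero (sym (mergeColumn-elsewhere (A zero) (p≢q ∘ sym))) (entries q))
      (det-incidence k (minor M q) (λ i → IncidenceRow-merge (rows (suc i)) p≢q)))
    where
    p≢q : p ≢ q
    p≢q refl = contradiction (trans (sym A₀p≡1) A₀q≡-1) λ ()
    M : Matrix (suc k) (suc k)
    M i = mergeColumn p q (A i)
    M₀≗0 : ∀ j → j ≢ q → M zero j ≡ + 0
    M₀≗0 j j≢q with j Fin.≟ p
    ... | yes refl = cong₂ _+_ A₀p≡1 A₀q≡-1
    ... | no j≢p   = vanishes j (j≢p ∘ λ A₀j≡1 → plus-unique j p A₀j≡1 A₀p≡1)
                                (j≢q ∘ λ A₀j≡-1 → minus-unique j q A₀j≡-1 A₀q≡-1)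
  by-first-row : Dec (∃ λ p → A zero p ≡ + 1) → Dec (∃ λ q → A zero q ≡ - (+ 1)) →
                 UnitOrZero (det (suc k) A)
  by-first-row (no ∄+1) (no ∄-1) =
    expand-at zero λ j _ → vanishes j (∄+1 ∘ (j ,_)) (∄-1 ∘ (j ,_))
  by-first-row (yes (p , A₀p≡1)) (no ∄-1) = expand-at p λ j j≢p →
    vanishes j (j≢p ∘ λ A₀j≡1 → plus-unique j p A₀j≡1 A₀p≡1) (∄-1 ∘ (j ,_))
  by-first-row (no ∄+1) (yes (q , A₀q≡-1)) = expand-at q λ j j≢q →
    vanishes j (∄+1 ∘ (j ,_)) (j≢q ∘ λ A₀j≡-1 → minus-unique j q A₀j≡-1 A₀q≡-1)
  by-first-row (yes (_ , A₀p≡1)) (yes (_ , A₀q≡-1)) = merge-and-expand A₀p≡1 A₀q≡-1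

ParentsAreRoots : ∀ {k} → (Fin k → Maybe (Fin k)) → Set
ParentsAreRoots parent = ∀ {c p} → parent c ≡ just p → p ≢ c × parent p ≡ nothing

subtractParents : ∀ {k} → (Fin k → Maybe (Fin k)) → Matrix k k → Matrix k k
subtractParents parent B i c = B i c - maybe (B i) (+ 0) (parent c)

module _ {k} {parent : Fin k → Maybe (Fin k)} (roots : ParentsAreRoots parent) (B : Matrix k k) where
  private
    R : Matrix k k
    R = subtractParents parent B

    reduced-below : ℕ → Matrix k k
    reduced-below t i c = if does (toℕ c <? t) then R i c else B i c

    below : ∀ {t i c} → toℕ c < t → reduced-below t i c ≡ R i c
    below {t} {c = c} c<t rewrite dec-true (toℕ c <? t) c<t = refl

    not-below : ∀ {t i c} → ¬ toℕ c < t → reduced-below t i c ≡ B i c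
    not-below {t} {c = c} c≮t rewrite dec-false (toℕ c <? t) c≮t = refl

    R-root : ∀ {i p} → parent p ≡ nothing → R i p ≡ B i p
    R-root {i} {p} eq rewrite eq = Int.+-identityʳ (B i p)

    reduced-below-root : ∀ {t i p} → parent p ≡ nothing → reduced-below t i p ≡ B i p
    reduced-below-root {t} {i} {p} eq with toℕ p <? t
    ... | yes p<t = trans (below p<t) (R-root eq)
    ... | no p≮t  = not-below p≮t

    module _ {t} (t<k : t < k) where
      c₀ : Fin k
      c₀ = fromℕ< t<k

      toℕ-c₀ : toℕ c₀ ≡ t
      toℕ-c₀ = Fin.toℕ-fromℕ< t<k

      at-c₀ : ∀ {i} → reduced-below (suc t) i c₀ ≡ R i c₀
      at-c₀ = below (ℕ.≤-reflexive (cong suc toℕ-c₀))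

      at-c₀′ : ∀ {i} → reduced-below t i c₀ ≡ B i c₀
      at-c₀′ = not-below (ℕ.<-irrefl toℕ-c₀)

      unchanged-elsewhere : ∀ i c → c ≢ c₀ → reduced-below (suc t) i c ≡ reduced-below t i c
      unchanged-elsewhere i c c≢c₀ with toℕ c <? t
      ... | yes c<t = trans (below (ℕ.m<n⇒m<1+n c<t)) (sym (below c<t))
      ... | no c≮t  = trans (not-below c≮1+t) (sym (not-below c≮t))
        where
        c≮1+t : ¬ toℕ c < suc t
        c≮1+t c<1+t with ℕ.m<1+n⇒m<n∨m≡n c<1+t
        ... | inj₁ c<t = c≮t c<t
        ... | inj₂ c≡t = c≢c₀ (Fin.toℕ-injective (trans c≡t (sym toℕ-c₀)))

      step : det k (reduced-below (suc t)) ≡ det k (reduced-below t)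
      step with parent c₀ in eq
      ... | nothing = det-cong k pointwise
        where
        pointwise : ∀ i c → reduced-below (suc t) i c ≡ reduced-below t i c
        pointwise i c with c Fin.≟ c₀
        ... | yes refl = trans at-c₀ (trans (R-root eq) (sym at-c₀′))
        ... | no c≢c₀  = unchanged-elsewhere i c c≢c₀
      ... | just p = det-subtract-column k (reduced-below t) (reduced-below (suc t)) (proj₁ (roots eq) ∘ sym)
                       column-c₀ unchanged-elsewhere
        where
        column-c₀ : ∀ i → reduced-below (suc t) i c₀ ≡ reduced-below t i c₀ - reduced-below t i p
        column-c₀ i = begin
          reduced-below (suc t) i c₀                  ≡⟨ at-c₀ ⟩
          B i c₀ - maybe (B i) (+ 0) (parent c₀)      ≡⟨ cong (λ m → B i c₀ - maybe (B i) (+ 0) m) eq ⟩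
          B i c₀ - B i p                              ≡⟨ cong₂ _-_ at-c₀′ (reduced-below-root {t} p-root) ⟨
          reduced-below t i c₀ - reduced-below t i p  ∎
          where
          p-root : parent p ≡ nothing
          p-root = proj₂ (roots eq)

    det-reduced-below : ∀ t → t ≤ k → det k (reduced-below t) ≡ det k B
    det-reduced-below zero    _   = det-cong k λ i c → not-below {0} λ ()
    det-reduced-below (suc t) t<k = trans (step t<k) (det-reduced-below t (ℕ.<⇒≤ t<k))

  det-subtractParents : det k (subtractParents parent B) ≡ det k B
  det-subtractParents = trans (det-cong k λ i c → sym (below (Fin.toℕ<n c))) (det-reduced-below k ℕ.≤-refl)

record AtMostOneHot {k} (v : Fin k → ℤ) : Set where
  field
    zero-or-one : ∀ j → v j ≡ + 0 ⊎ v j ≡ + 1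
    one-unique  : AtMostOne (λ j → v j ≡ + 1)

IncidenceRow-difference : ∀ {k} {a b : Fin k → ℤ} → AtMostOneHot a → AtMostOneHot b →
                          IncidenceRow (λ j → a j - b j)
IncidenceRow-difference {a = a} {b} a-hot b-hot = record
  { entries      = λ j → entry (A.zero-or-one j) (B.zero-or-one j)
  ; plus-unique  = λ j j′ eq eq′ → A.one-unique j j′ (plus (A.zero-or-one j) (B.zero-or-one j) eq)
                                                     (plus (A.zero-or-one j′) (B.zero-or-one j′) eq′)
  ; minus-unique = λ j j′ eq eq′ → B.one-unique j j′ (minus (A.zero-or-one j) (B.zero-or-one j) eq)
                                                     (minus (A.zero-or-one j′) (B.zero-or-one j′) eq′)
  }
  where
  module A = AtMostOneHot a-hot
  module B = AtMostOneHot b-hot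
  entry : ∀ {x y} → x ≡ + 0 ⊎ x ≡ + 1 → y ≡ + 0 ⊎ y ≡ + 1 → UnitOrZero (x - y)
  entry (inj₁ refl) (inj₁ refl) = inj₁ refl
  entry (inj₁ refl) (inj₂ refl) = inj₂ (inj₂ refl)
  entry (inj₂ refl) (inj₁ refl) = inj₂ (inj₁ refl)
  entry (inj₂ refl) (inj₂ refl) = inj₁ refl
  plus : ∀ {x y} → x ≡ + 0 ⊎ x ≡ + 1 → y ≡ + 0 ⊎ y ≡ + 1 → x - y ≡ + 1 → x ≡ + 1
  plus (inj₂ refl) _           _  = refl
  plus (inj₁ refl) (inj₁ refl) ()
  plus (inj₁ refl) (inj₂ refl) ()
  minus : ∀ {x y} → x ≡ + 0 ⊎ x ≡ + 1 → y ≡ + 0 ⊎ y ≡ + 1 → x - y ≡ - (+ 1) → y ≡ + 1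
  minus _           (inj₂ refl) _  = refl
  minus (inj₁ refl) (inj₁ refl) ()
  minus (inj₂ refl) (inj₁ refl) ()

module _ {n : ℕ} {_≺_ : Fin n → Fin n → Set} (_≺?_ : ∀ x y → Dec (x ≺ y)) (ℓ r : Fin n → ℕ) where
  private
    Column : Set
    Column = Fin (n ℕ.+ n)
    cℓ cρ : Fin n → Column
    cℓ = colℓ _≺?_ ℓ r
    cρ = colρ _≺?_ ℓ r
    δ′ : Column → Column → ℤ
    δ′ = δ _≺?_ ℓ r

  δ-refl : ∀ c → δ′ c c ≡ + 1
  δ-refl c with c Fin.≟ c
  ... | yes _  = refl
  ... | no c≢c = contradiction refl c≢c

  δ-≢ : ∀ {c d} → c ≢ d → δ′ c d ≡ + 0
  δ-≢ {c} {d} c≢d with c Fin.≟ d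
  ... | yes c≡d = contradiction c≡d c≢d
  ... | no _    = refl

  δ≡1⇒≡ : ∀ {c d} → δ′ c d ≡ + 1 → c ≡ d
  δ≡1⇒≡ {c} {d} eq with c Fin.≟ d
  ... | yes c≡d = c≡d

  ℓ≢ρ : ∀ {x y} → cℓ x ≢ cρ y
  ℓ≢ρ {x} {y} eq
    with () ← trans (sym (Fin.splitAt-↑ˡ n x n)) (trans (cong (splitAt n) eq) (Fin.splitAt-↑ʳ n n y))

  δ-ℓℓ≡δ-ρρ : ∀ x y → δ′ (cℓ x) (cℓ y) ≡ δ′ (cρ x) (cρ y)
  δ-ℓℓ≡δ-ρρ x y with x Fin.≟ y
  ... | yes refl = trans (δ-refl (cℓ x)) (sym (δ-refl (cρ x)))
  ... | no x≢y   =
    trans (δ-≢ (x≢y ∘ Fin.↑ˡ-injective n x y)) (sym (δ-≢ (x≢y ∘ Fin.↑ʳ-injective n x y)))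

  δ-ρ-ℓ : ∀ {c x y} → c ≡ cρ x → δ′ c (cℓ y) ≡ + 0
  δ-ρ-ℓ refl = δ-≢ (ℓ≢ρ ∘ sym)

  data Endpoint : Set where
    left right : Fin n → Endpoint
    origin     : Endpoint

  coefficients : Endpoint → Column → ℤ
  coefficients (left x)  c = δ′ c (cℓ x)
  coefficients (right x) c = δ′ c (cℓ x) + δ′ c (cρ x)
  coefficients origin    c = + 0

  record EndpointDifference (v : Column → ℤ) : Set where
    field
      positive negative : Endpoint
      difference        : ∀ c → v c ≡ coefficients positive c - coefficients negative c

  coverRow-difference : ∀ x y → EndpointDifference (coverRow _≺?_ ℓ r x y)
  coverRow-difference x y = record
    { positive = right x ; negative = left y ; difference = λ _ → refl }

  sharpRow-difference : ∀ x y → EndpointDifference (sharpRow _≺?_ ℓ r x y)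
  sharpRow-difference x y = record
    { positive = left x ; negative = right y
    ; difference = λ c → regroup (δ′ c (cℓ x)) (δ′ c (cℓ y)) (δ′ c (cρ y)) }
    where
    regroup : ∀ a b d → a - b - d ≡ a - (b + d)
    regroup = solve-∀

  diagRow-difference : ∀ x → EndpointDifference (diagRow _≺?_ ℓ r x)
  diagRow-difference x = record
    { positive = left x ; negative = right x ; difference = λ c → regroup (δ′ c (cℓ x)) (δ′ c (cρ x)) }
    where
    regroup : ∀ a d → - d ≡ a - (a + d)
    regroup = solve-∀

  leftRow-difference : ∀ x → EndpointDifference (leftRow _≺?_ ℓ r x)
  leftRow-difference x = record
    { positive = origin ; negative = left x ; difference = λ c → sym (Int.+-identityˡ (- δ′ c (cℓ x))) }

  private
    ∈-concatMap-allFin⁻ : ∀ {A : Set} {m} {f : Fin m → List A} {v} →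
                          v ∈ concatMap f (allFin m) → ∃ λ x → v ∈ f x
    ∈-concatMap-allFin⁻ {m = m} {f} = satisfied ∘ ∈-concatMap⁻ f {allFin m}

  rowsP-differences : ∀ {v} → v ∈ rowsP _≺?_ ℓ r → EndpointDifference v
  rowsP-differences v∈ with ∈-++⁻ (concatMap _ (allFin n)) v∈
  ... | inj₁ v∈covers
    with x , v∈covers-x ← ∈-concatMap-allFin⁻ v∈covers
    with y , v∈cover ← ∈-concatMap-allFin⁻ v∈covers-x
    with x ≺? y | slack _≺?_ ℓ r x y ℤ.≟ + 0 | v∈cover
  ...   | yes _ | yes _ | here refl = coverRow-difference x y
  rowsP-differences v∈ | inj₂ v∈rest with ∈-++⁻ (concatMap _ (allFin n)) v∈rest
  ... | inj₁ v∈sharps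
    with x , v∈sharps-x ← ∈-concatMap-allFin⁻ v∈sharps
    with y , v∈sharp ← ∈-concatMap-allFin⁻ v∈sharps-x
    with x Fin.≟ y | x ≺? y | y ≺? x | slack _≺?_ ℓ r x y ℤ.≟ + 0 | v∈sharp
  ...   | no _ | no _ | no _ | yes _ | here refl = sharpRow-difference x y
  rowsP-differences v∈ | inj₂ v∈rest | inj₂ v∈rest′ with ∈-++⁻ (concatMap _ (allFin n)) v∈rest′
  ... | inj₁ v∈diags
    with x , v∈diag ← ∈-concatMap-allFin⁻ v∈diags
    with slack _≺?_ ℓ r x x ℤ.≟ + 0 | v∈diag
  ...   | yes _ | here refl = diagRow-difference x
  rowsP-differences v∈ | inj₂ v∈rest | inj₂ v∈rest′ | inj₂ v∈lefts
    with x , here refl ← ∈-concatMap-allFin⁻ {f = λ x → leftRow _≺?_ ℓ r x ∷ []} v∈lefts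
    = leftRow-difference x

  M_P-differences : ∀ i → EndpointDifference (M_P _≺?_ ℓ r i)
  M_P-differences i = rowsP-differences (∈-lookup i)

  indicator : Maybe Column → Column → ℤ
  indicator nothing  _ = + 0
  indicator (just d) c = δ′ c d

  indicator-AtMostOneHot : ∀ {k} {cs : Fin k → Column} → Injective _≡_ _≡_ cs →
                           ∀ t → AtMostOneHot (λ c → indicator t (cs c))
  indicator-AtMostOneHot cs-inj nothing  = record { zero-or-one = λ _ → inj₁ refl ; one-unique = λ _ _ () }
  indicator-AtMostOneHot {cs = cs} cs-inj (just d) = record
    { zero-or-one = λ c → zero-or-one (cs c)
    ; one-unique  = λ c c′ eq eq′ → cs-inj (trans (δ≡1⇒≡ eq) (sym (δ≡1⇒≡ eq′)))
    }
    where
    zero-or-one : ∀ c → δ′ c d ≡ + 0 ⊎ δ′ c d ≡ + 1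
    zero-or-one c with c Fin.≟ d
    ... | yes _ = inj₂ refl
    ... | no _  = inj₁ refl

  module _ {k} (cs : Fin k → Column) where
    ρ-selected? : ∀ x → Dec (∃ λ p → cs p ≡ cρ x)
    ρ-selected? x = Fin.any? λ p → cs p Fin.≟ cρ x

    data ColumnKind (c : Fin k) : Set where
      ℓ-with-ρ    : ∀ x p → cs c ≡ cℓ x → cs p ≡ cρ x → ColumnKind c
      ℓ-without-ρ : ∀ x → cs c ≡ cℓ x → ¬ ∃ (λ p → cs p ≡ cρ x) → ColumnKind c
      ρ-column    : ∀ x → cs c ≡ cρ x → ColumnKind c

    kind : ∀ c → ColumnKind c
    kind c with splitAt n (cs c) in eq
    ... | inj₂ x = ρ-column x (sym (Fin.splitAt⁻¹-↑ʳ eq))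
    ... | inj₁ x with ρ-selected? x
    ...   | yes (p , cs-p) = ℓ-with-ρ x p (sym (Fin.splitAt⁻¹-↑ˡ eq)) cs-p
    ...   | no ∄p          = ℓ-without-ρ x (sym (Fin.splitAt⁻¹-↑ˡ eq)) ∄p

    partner : Fin k → Maybe (Fin k)
    partner c with kind c
    ... | ℓ-with-ρ _ p _ _ = just p
    ... | ℓ-without-ρ _ _ _ = nothing
    ... | ρ-column _ _      = nothing

    partner-ρ : ∀ {p x} → cs p ≡ cρ x → partner p ≡ nothing
    partner-ρ {p} cs-p with kind p
    ... | ℓ-with-ρ _ _ cs-p′ _ = contradiction (trans (sym cs-p′) cs-p) ℓ≢ρ
    ... | ℓ-without-ρ _ cs-p′ _ = contradiction (trans (sym cs-p′) cs-p) ℓ≢ρ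
    ... | ρ-column _ _          = refl

    partner-roots : ParentsAreRoots partner
    partner-roots {c} eq with kind c
    partner-roots refl | ℓ-with-ρ x p cs-c cs-p =
      (λ p≡c → ℓ≢ρ (trans (sym cs-c) (trans (cong cs (sym p≡c)) cs-p))) , partner-ρ cs-p

    -- After the reduction, rₓ is represented by the column ρₓ if it is selected, and by ℓₓ otherwise.
    target : Endpoint → Maybe Column
    target (left x)  = just (cℓ x)
    target (right x) with ρ-selected? x
    ... | yes _ = just (cρ x)
    ... | no _  = just (cℓ x)
    target origin    = nothing

    partnerCoefficient : Endpoint → Fin k → ℤ
    partnerCoefficient e c = maybe (coefficients e ∘ cs) (+ 0) (partner c)

    reducedCoefficients : Endpoint → Fin k → ℤ
    reducedCoefficients e c = coefficients e (cs c) - partnerCoefficient e c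

    reduced-origin : ∀ c → reducedCoefficients origin c ≡ + 0
    reduced-origin c with partner c
    ... | nothing = refl
    ... | just _  = refl

    reduced-left : ∀ y c → reducedCoefficients (left y) c ≡ δ′ (cs c) (cℓ y)
    reduced-left y c with kind c
    ... | ℓ-with-ρ _ _ _ cs-p = trans (cong (_-_ (δ′ (cs c) (cℓ y))) (δ-ρ-ℓ cs-p)) (Int.+-identityʳ _)
    ... | ℓ-without-ρ _ _ _   = Int.+-identityʳ _
    ... | ρ-column _ _        = Int.+-identityʳ _

    partnerCoefficient-right-selected : ∀ {y} → ∃ (λ q → cs q ≡ cρ y) → ∀ c →
                                        partnerCoefficient (right y) c ≡ δ′ (cs c) (cℓ y)
    partnerCoefficient-right-selected {y} (q , cs-q) c with kind c
    ... | ℓ-with-ρ x p cs-c cs-p = begin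
      δ′ (cs p) (cℓ y) + δ′ (cs p) (cρ y)  ≡⟨ cong (λ d → δ′ d (cℓ y) + δ′ d (cρ y)) cs-p ⟩
      δ′ (cρ x) (cℓ y) + δ′ (cρ x) (cρ y)  ≡⟨ cong (λ a → a + δ′ (cρ x) (cρ y)) (δ-ρ-ℓ refl) ⟩
      + 0 + δ′ (cρ x) (cρ y)               ≡⟨ Int.+-identityˡ _ ⟩
      δ′ (cρ x) (cρ y)                     ≡⟨ δ-ℓℓ≡δ-ρρ x y ⟨
      δ′ (cℓ x) (cℓ y)                     ≡⟨ cong (λ d → δ′ d (cℓ y)) cs-c ⟨
      δ′ (cs c) (cℓ y)                     ∎
    ... | ℓ-without-ρ x cs-c ∄p = sym (trans (cong (λ d → δ′ d (cℓ y)) cs-c)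
      (δ-≢ λ ℓx≡ℓy → ∄p (q , trans cs-q (cong cρ (sym (Fin.↑ˡ-injective n x y ℓx≡ℓy))))))
    ... | ρ-column x cs-c = sym (δ-ρ-ℓ cs-c)

    partnerCoefficient-right-unselected : ∀ {y} → ¬ ∃ (λ q → cs q ≡ cρ y) → ∀ c →
                                          partnerCoefficient (right y) c ≡ + 0
    partnerCoefficient-right-unselected {y} ∄q c with kind c
    ... | ℓ-with-ρ x p _ cs-p = cong₂ _+_ (δ-ρ-ℓ cs-p) (δ-≢ λ eq → ∄q (p , eq))
    ... | ℓ-without-ρ _ _ _   = refl
    ... | ρ-column _ _        = refl

    reduced-right : ∀ y c → reducedCoefficients (right y) c ≡ indicator (target (right y)) (cs c)
    reduced-right y c with ρ-selected? y
    ... | yes ∃q = begin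
      δ′ (cs c) (cℓ y) + δ′ (cs c) (cρ y) - partnerCoefficient (right y) c
        ≡⟨ cong (_-_ (δ′ (cs c) (cℓ y) + δ′ (cs c) (cρ y))) (partnerCoefficient-right-selected ∃q c) ⟩
      δ′ (cs c) (cℓ y) + δ′ (cs c) (cρ y) - δ′ (cs c) (cℓ y)
        ≡⟨ cancel (δ′ (cs c) (cℓ y)) (δ′ (cs c) (cρ y)) ⟩
      δ′ (cs c) (cρ y) ∎
      where
      cancel : ∀ a b → a + b - a ≡ b
      cancel = solve-∀
    ... | no ∄q = begin
      δ′ (cs c) (cℓ y) + δ′ (cs c) (cρ y) - partnerCoefficient (right y) c
        ≡⟨ cong₂ (λ b m → δ′ (cs c) (cℓ y) + b - m) (δ-≢ λ eq → ∄q (c , eq))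
                 (partnerCoefficient-right-unselected ∄q c) ⟩
      δ′ (cs c) (cℓ y) + + 0 - + 0
        ≡⟨ cancel (δ′ (cs c) (cℓ y)) ⟩
      δ′ (cs c) (cℓ y) ∎
      where
      cancel : ∀ a → a + + 0 - + 0 ≡ a
      cancel = solve-∀

    reducedCoefficients-indicator : ∀ e c → reducedCoefficients e c ≡ indicator (target e) (cs c)
    reducedCoefficients-indicator (left y)  = reduced-left y
    reducedCoefficients-indicator (right y) = reduced-right y
    reducedCoefficients-indicator origin    = reduced-origin

    reduced-difference : ∀ {v} (v-diff : EndpointDifference v) → let open EndpointDifference v-diff in
      ∀ c → v (cs c) - maybe (v ∘ cs) (+ 0) (partner c)
              ≡ indicator (target positive) (cs c) - indicator (target negative) (cs c)
    reduced-difference {v} v-diff c = begin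
      v (cs c) - maybe (v ∘ cs) (+ 0) (partner c)
        ≡⟨ cong₂ _-_ (difference (cs c)) (maybe-difference (partner c)) ⟩
      (coefficients positive (cs c) - coefficients negative (cs c))
        - (partnerCoefficient positive c - partnerCoefficient negative c)
        ≡⟨ regroup (coefficients positive (cs c)) (coefficients negative (cs c))
                   (partnerCoefficient positive c) (partnerCoefficient negative c) ⟩
      reducedCoefficients positive c - reducedCoefficients negative c
        ≡⟨ cong₂ _-_ (reducedCoefficients-indicator positive c) (reducedCoefficients-indicator negative c) ⟩
      indicator (target positive) (cs c) - indicator (target negative) (cs c) ∎
      where
      open EndpointDifference v-diff
      maybe-difference : ∀ m → maybe (v ∘ cs) (+ 0) m
                               ≡ maybe (coefficients positive ∘ cs) (+ 0) m - maybe (coefficients negative ∘ cs) (+ 0) m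
      maybe-difference nothing  = refl
      maybe-difference (just p) = difference (cs p)
      regroup : ∀ a b a′ b′ → (a - b) - (a′ - b′) ≡ (a - a′) - (b - b′)
      regroup = solve-∀

  endpointDifferences-TU : ∀ {m} (M : Matrix m (n ℕ.+ n)) → (∀ i → EndpointDifference (M i)) →
                           TotallyUnimodular M
  endpointDifferences-TU M rows k rs cs _ cs-inj = subst UnitOrZero (det-subtractParents (partner-roots cs) B)
    (det-incidence k (subtractParents (partner cs) B) reduced-rows)
    where
    B : Matrix k k
    B i c = M (rs i) (cs c)
    reduced-rows : ∀ i → IncidenceRow (subtractParents (partner cs) B i)
    reduced-rows i = IncidenceRow-cong (sym ∘ reduced-difference cs (rows (rs i)))
      (IncidenceRow-difference (indicator-AtMostOneHot cs-inj (target cs positive))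
                               (indicator-AtMostOneHot cs-inj (target cs negative)))
      where open EndpointDifference (rows (rs i))

theorem3p1 : (n : ℕ) (_≺_ : Fin n → Fin n → Set)
    (_≺?_ : ∀ x y → Dec (x ≺ y)) (ℓ r : Fin n → ℕ) →
    IsCanonicalRep _≺_ ℓ r →
    TotallyUnimodular (M_P _≺?_ ℓ r)
theorem3p1 n _≺_ _≺?_ ℓ r _ =
  endpointDifferences-TU _≺?_ ℓ r (M_P _≺?_ ℓ r) (M_P-differences _≺?_ ℓ r)
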